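{- Let $n\in\mathbb{Z}^+$ and let $\phi:\mathbb{B}^n\to\mathbb{B}$ be given as a DNF with $k$ conjunctive clauses, $\phi(\mathbf{y})=\bigvee_{j=1}^k c_j(\mathbf{y})$. Define the Boolean network $f:\mathbb{B}^{n+k+2}\to\mathbb{B}^{n+k+2}$ by $f_i(\mathbf{x})=(\mathbf{x}_i\wedge\neg\mathbf{x}_{n+k+1})\vee\mathbf{x}_{n+k+2}$ for $i\in[1,n]$; $f_{n+j}(\mathbf{x})=(c_j(\mathbf{x}_{[1,n]})\wedge\neg\mathbf{x}_{n+k+1})\vee\mathbf{x}_{n+k+2}$ for $j\in[1,k]$; $f_{n+k+1}(\mathbf{x})=\left(\bigvee_{j=1}^k\mathbf{x}_{n+j}\right)\wedge\neg\mathbf{x}_{n+k+2}$; $f_{n+k+2}(\mathbf{x})=\mathbf{x}_{n+k+1}\wedge\neg\mathbf{x}_{n+k+2}$. Then $\forall\mathbf{y}\,\phi(\mathbf{y})$ is true if and only if $*^{n+k+2}$ is the unique minimal trap space of $f$.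
   Context: $\mathbb{B}=\{0,1\}$, $[a,b]=\{a,\dots,b\}$, $\mathbf{x}_{[a,b]}=(\mathbf{x}_a,\dots,\mathbf{x}_b)$. A DNF is a disjunction of conjunctive clauses, each clause a conjunction of literals (variables or negated variables); a DNF with $k=0$ clauses is identically false and an empty clause is identically true. A Boolean network of dimension $m$ is a map $f:\mathbb{B}^m\to\mathbb{B}^m$ with local functions $f_i$. A sub-hypercube is a vector $\mathbf{h}\in\{0,1,*\}^m$ with vertex set $v(\mathbf{h})=\{\mathbf{x}\in\mathbb{B}^m:\forall i,\ \mathbf{h}_i\neq *\Rightarrow\mathbf{x}_i=\mathbf{h}_i\}$. A trap space of $f$ is a sub-hypercube $\mathbf{h}$ with $f(\mathbf{x})\in v(\mathbf{h})$ for all $\mathbf{x}\in v(\mathbf{h})$; it is minimal if there is no trap space $\mathbf{h}'$ with $v(\mathbf{h}')\subsetneq v(\mathbf{h})$. $*^m$ is the sub-hypercube with all entries $*$. -}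

module Defs where

open import Data.Bool using (Bool; true; false; _∧_; _∨_; not; if_then_else_)
open import Data.Nat using (ℕ; _+_)
open import Data.Fin using (Fin; splitAt; zero; suc; _↑ˡ_; _↑ʳ_)
open import Data.List using (List; length)
open import Data.Bool.ListAction using (all; any)
open import Data.Maybe using (Maybe; just; nothing)
open import Data.Product using (_×_; _,_; Σ)
open import Data.Sum using (_⊎_; inj₁; inj₂)
open import Relation.Binary.PropositionalEquality using (_≡_)
open import Relation.Nullary using (¬_)

State : ℕ → Set
State m = Fin m → Bool

BN : ℕ → Set
BN m = State m → State m

Literal : ℕ → Set
Literal n = Fin n × Bool

evalLit : ∀ {n} → Literal n → State n → Bool
evalLit (i , true)  y = y i
evalLit (i , false) y = not (y i)

Clause : ℕ → Set
Clause n = List (Literal n)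

evalClause : ∀ {n} → Clause n → State n → Bool
evalClause c y = all (λ l → evalLit l y) c

DNF : ℕ → Set
DNF n = List (Clause n)

evalDNF : ∀ {n} → DNF n → State n → Bool
evalDNF φ y = any (λ c → evalClause c y) φ

-- Clause c_j (j ∈ Fin k, 0-based) of a DNF with k = length φ clauses.
clause : ∀ {n} (φ : DNF n) → Fin (length φ) → Clause n
clause φ j = Data.List.lookup φ j

anyFin : ∀ {k} → (Fin k → Bool) → Bool
anyFin {ℕ.zero} g = false
anyFin {ℕ.suc k} g = g zero ∨ anyFin (λ j → g (suc j))

-- Index maps into [1, n+k+2] (0-based here).
varIdx : ∀ n k → Fin n → Fin (n + k + 2)
varIdx n k i = (i ↑ˡ k) ↑ˡ 2

clauseIdx : ∀ n k → Fin k → Fin (n + k + 2)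
clauseIdx n k j = (n ↑ʳ j) ↑ˡ 2

idxA : ∀ n k → Fin (n + k + 2)   -- index n+k+1 (1-based)
idxA n k = (n + k) ↑ʳ zero

idxB : ∀ n k → Fin (n + k + 2)   -- index n+k+2 (1-based)
idxB n k = (n + k) ↑ʳ suc zero

network : ∀ {n} (φ : DNF n) → BN (n + length φ + 2)
network {n} φ x i = go (splitAt (n + k) i)
  where
  k = length φ
  a = x (idxA n k)
  b = x (idxB n k)
  go : Fin (n + k) ⊎ Fin 2 → Bool
  go (inj₂ zero)       = anyFin (λ j → x (clauseIdx n k j)) ∧ not b
  go (inj₂ (suc zero)) = a ∧ not b
  go (inj₁ i') with splitAt n i'
  ... | inj₁ v = (x (varIdx n k v) ∧ not a) ∨ b
  ... | inj₂ j = (evalClause (clause φ j) (λ v → x (varIdx n k v)) ∧ not a) ∨ b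

-- Sub-hypercubes: nothing = *, just b = fixed value b.
SubHypercube : ℕ → Set
SubHypercube m = Fin m → Maybe Bool

_∈v_ : ∀ {m} → State m → SubHypercube m → Set
_∈v_ {m} x h = ∀ (i : Fin m) (b : Bool) → h i ≡ just b → x i ≡ b

_⊆v_ : ∀ {m} → SubHypercube m → SubHypercube m → Set
_⊆v_ {m} h h' = ∀ (x : State m) → x ∈v h → x ∈v h'

IsTrapSpace : ∀ {m} → BN m → SubHypercube m → Set
IsTrapSpace {m} f h = ∀ (x : State m) → x ∈v h → f x ∈v h

IsMinimalTrapSpace : ∀ {m} → BN m → SubHypercube m → Set
IsMinimalTrapSpace {m} f h =
  IsTrapSpace f h ×
  ¬ (Σ (SubHypercube m) λ h' → IsTrapSpace f h' × h' ⊆v h × ¬ (h ⊆v h'))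

allStar : ∀ {m} → SubHypercube m
allStar _ = nothing

UniqueMinimalAllStar : ∀ {m} → BN m → Set
UniqueMinimalAllStar {m} f =
  IsMinimalTrapSpace f allStar ×
  (∀ (h : SubHypercube m) → IsMinimalTrapSpace f h → ∀ i → h i ≡ allStar i)

{-# OPTIONS --safe #-}
-- The control coordinates a = x_{n+k+1} and b = x_{n+k+2} drive f: b = 1 sets every
-- other coordinate to 1 and a, b to 0, while a = 1, b = 0 clears every other coordinate
-- and sets b. Hence a trap space can fix neither a nor b, except possibly a at 0; but
-- then f_a = ⋁ⱼ x_{n+j} forces every clause coordinate to be fixed at 0, which a valid φ
-- refutes at any vertex (some clause holds there and f switches its coordinate on).
-- With a and b free, the two resets show that no other coordinate is fixed either, so
-- *ⁿ⁺ᵏ⁺² is the only trap space. Conversely, if φ(y) = 0 then (y, 0, …, 0) is a fixed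
-- point of f, a trap space strictly inside *ⁿ⁺ᵏ⁺².
module Submission where

open import Defs
open import Data.Nat using (ℕ; NonZero; _+_)
open import Data.Bool using (Bool; true; false; _∧_; _∨_; not)
open import Data.Bool.Properties using (∨-zeroʳ; ∧-zeroʳ; ∧-identityʳ; ∨-identityʳ; not-¬; ¬-not)
open import Data.List using (length; []; _∷_)
open import Data.Fin using (Fin; zero; suc; splitAt; _↑ˡ_; _↑ʳ_)
open import Data.Fin.Properties using (splitAt-↑ˡ; splitAt-↑ʳ; splitAt⁻¹-↑ˡ; splitAt⁻¹-↑ʳ)
open import Data.Maybe using (Maybe; just; nothing; fromMaybe)
open import Data.Product using (Σ; _,_; proj₁)
open import Data.Sum using (_⊎_; inj₁; inj₂; [_,_]′)
open import Function using (_∘_; const)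
open import Function.Bundles using (_⇔_; mk⇔)
open import Data.Empty using (⊥)
open import Relation.Nullary using (¬_; contradiction)
open import Relation.Binary.PropositionalEquality

≡false-contra : ∀ {a b} → (a ≡ true → b ≡ true) → b ≡ false → a ≡ false
≡false-contra {false} _   _    = refl
≡false-contra {true}  a⇒b refl with a⇒b refl
... | ()

anyFin-true : ∀ {k} (g : Fin k → Bool) j → g j ≡ true → anyFin g ≡ true
anyFin-true g zero    gj rewrite gj = refl
anyFin-true g (suc j) gj rewrite anyFin-true (g ∘ suc) j gj = ∨-zeroʳ (g zero)

anyFin-false : ∀ {k} (g : Fin k → Bool) → (∀ j → g j ≡ false) → anyFin g ≡ false
anyFin-false {ℕ.zero}  g none = refl
anyFin-false {ℕ.suc k} g none rewrite none zero = anyFin-false (g ∘ suc) (none ∘ suc)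

anyFin-false⁻ : ∀ {k} (g : Fin k → Bool) → anyFin g ≡ false → ∀ j → g j ≡ false
anyFin-false⁻ g none j = ≡false-contra (anyFin-true g j) none

evalClause-cong : ∀ {n} (c : Clause n) {y y′ : State n} → y ≗ y′ →
                  evalClause c y ≡ evalClause c y′
evalClause-cong []                y≗y′ = refl
evalClause-cong ((v , true)  ∷ c) y≗y′ = cong₂ _∧_ (y≗y′ v) (evalClause-cong c y≗y′)
evalClause-cong ((v , false) ∷ c) y≗y′ =
  cong₂ _∧_ (cong not (y≗y′ v)) (evalClause-cong c y≗y′)

evalDNF-true : ∀ {n} (φ : DNF n) y j → evalClause (clause φ j) y ≡ true → evalDNF φ y ≡ true
evalDNF-true (c ∷ φ) y zero    cy rewrite cy = refl
evalDNF-true (c ∷ φ) y (suc j) cy rewrite evalDNF-true φ y j cy = ∨-zeroʳ (evalClause c y)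

evalDNF-true⁻ : ∀ {n} (φ : DNF n) y → evalDNF φ y ≡ true →
                Σ (Fin (length φ)) λ j → evalClause (clause φ j) y ≡ true
evalDNF-true⁻ (c ∷ φ) y φy with evalClause c y in cy
... | true  = zero , cy
... | false with evalDNF-true⁻ φ y φy
...   | j , φjy = suc j , φjy

evalDNF-false⁻ : ∀ {n} (φ : DNF n) y → evalDNF φ y ≡ false →
                 ∀ j → evalClause (clause φ j) y ≡ false
evalDNF-false⁻ φ y none j = ≡false-contra (evalDNF-true φ y j) none

free-if-unfixed : ∀ {c : Maybe Bool} → ¬ (c ≡ just true) → ¬ (c ≡ just false) → c ≡ nothing
free-if-unfixed {nothing}    _     _      = refl
free-if-unfixed {just true}  ¬true _      = contradiction refl ¬true
free-if-unfixed {just false} _     ¬false = contradiction refl ¬false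

module _ {m : ℕ} where

  opaque
    vertex : SubHypercube m → State m → State m
    vertex h d i = fromMaybe (d i) (h i)

    vertex-∈v : ∀ h d → vertex h d ∈v h
    vertex-∈v h d i b hi rewrite hi = refl

    vertex-free : ∀ {h d i} → h i ≡ nothing → vertex h d i ≡ d i
    vertex-free hi rewrite hi = refl

    vertex-moved : ∀ {h d i c} → vertex h d i ≡ c → d i ≡ not c → h i ≡ just c
    vertex-moved {h} {d} {i} with h i
    ... | just _  = λ vc _ → cong just vc
    ... | nothing = λ dc d¬c → contradiction d¬c (not-¬ dc)

  trap-clash : ∀ {f : BN m} {h x i c} → IsTrapSpace f h → x ∈v h → h i ≡ just c →
               f x i ≡ not c → ⊥
  trap-clash trap x∈h hi fx = not-¬ refl (trans (sym (trap _ x∈h _ _ hi)) fx)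

  uniqueMinimalAllStar-intro : ∀ {f : BN m} → (∀ h → IsTrapSpace f h → ∀ i → h i ≡ nothing) →
                               UniqueMinimalAllStar f
  uniqueMinimalAllStar-intro allFree =
    ( (λ _ _ _ _ ())
    , λ (h , trap , _ , allStar⊈h) →
        allStar⊈h λ _ _ i _ hi → contradiction (trans (sym (allFree h trap i)) hi) λ ())
    , λ h minimal → allFree h (proj₁ minimal)

  allStar-minimal⇒unfixed : ∀ {f : BN m} {h i c} → IsMinimalTrapSpace f allStar →
                            IsTrapSpace f h → ¬ (h i ≡ just c)
  allStar-minimal⇒unfixed {c = c} (_ , noSmaller) trap hi =
    noSmaller (_ , trap , (λ _ _ _ _ ()) ,
               λ allStar⊆h → not-¬ refl (sym (allStar⊆h (const (not c)) (λ _ _ ()) _ _ hi)))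

data Coordinate (n k : ℕ) : Fin (n + k + 2) → Set where
  var : ∀ v → Coordinate n k (varIdx n k v)
  cls : ∀ j → Coordinate n k (clauseIdx n k j)
  ctlA : Coordinate n k (idxA n k)
  ctlB : Coordinate n k (idxB n k)

coordinate : ∀ n k i → Coordinate n k i
coordinate n k i with splitAt (n + k) i in i≡
... | inj₂ zero       = subst (Coordinate n k) (splitAt⁻¹-↑ʳ i≡) ctlA
... | inj₂ (suc zero) = subst (Coordinate n k) (splitAt⁻¹-↑ʳ i≡) ctlB
... | inj₁ i′ with splitAt n i′ in i′≡
...   | inj₁ v = subst (Coordinate n k)
                   (trans (cong (_↑ˡ 2) (splitAt⁻¹-↑ˡ i′≡)) (splitAt⁻¹-↑ˡ i≡)) (var v)
...   | inj₂ j = subst (Coordinate n k)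
                   (trans (cong (_↑ˡ 2) (splitAt⁻¹-↑ʳ i′≡)) (splitAt⁻¹-↑ˡ i≡)) (cls j)

pair : Bool → Bool → Fin 2 → Bool
pair a _ zero       = a
pair _ b (suc zero) = b

opaque
  assemble : ∀ n k → State n → (Fin k → Bool) → Bool → Bool → State (n + k + 2)
  assemble n k y z a b = [ [ y , z ]′ ∘ splitAt n , pair a b ]′ ∘ splitAt (n + k)

  assemble-var : ∀ {n k y z a b} v → assemble n k y z a b (varIdx n k v) ≡ y v
  assemble-var {n} {k} {y} {z} {a} {b} v =
    trans (cong [ [ y , z ]′ ∘ splitAt n , pair a b ]′ (splitAt-↑ˡ (n + k) (v ↑ˡ k) 2))
          (cong [ y , z ]′ (splitAt-↑ˡ n v k))

  assemble-cls : ∀ {n k y z a b} j → assemble n k y z a b (clauseIdx n k j) ≡ z j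
  assemble-cls {n} {k} {y} {z} {a} {b} j =
    trans (cong [ [ y , z ]′ ∘ splitAt n , pair a b ]′ (splitAt-↑ˡ (n + k) (n ↑ʳ j) 2))
          (cong [ y , z ]′ (splitAt-↑ʳ n k j))

  assemble-A : ∀ {n k y z a b} → assemble n k y z a b (idxA n k) ≡ a
  assemble-A {n} {k} {y} {z} {a} {b} =
    cong [ [ y , z ]′ ∘ splitAt n , pair a b ]′ (splitAt-↑ʳ (n + k) 2 zero)

  assemble-B : ∀ {n k y z a b} → assemble n k y z a b (idxB n k) ≡ b
  assemble-B {n} {k} {y} {z} {a} {b} =
    cong [ [ y , z ]′ ∘ splitAt n , pair a b ]′ (splitAt-↑ʳ (n + k) 2 (suc zero))

module _ {n : ℕ} (φ : DNF n) {x : State (n + length φ + 2)} where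
  private
    k : ℕ
    k = length φ
    A B : Fin (n + k + 2)
    A = idxA n k
    B = idxB n k

  network-var : ∀ v → network φ x (varIdx n k v) ≡ (x (varIdx n k v) ∧ not (x A)) ∨ x B
  network-var v rewrite splitAt-↑ˡ (n + k) (v ↑ˡ k) 2 | splitAt-↑ˡ n v k = refl

  network-cls : ∀ j → network φ x (clauseIdx n k j) ≡
                      (evalClause (clause φ j) (x ∘ varIdx n k) ∧ not (x A)) ∨ x B
  network-cls j rewrite splitAt-↑ˡ (n + k) (n ↑ʳ j) 2 | splitAt-↑ʳ n k j = refl

  network-A : network φ x A ≡ anyFin (x ∘ clauseIdx n k) ∧ not (x B)
  network-A rewrite splitAt-↑ʳ (n + k) 2 zero = refl

  network-B : network φ x B ≡ x A ∧ not (x B)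
  network-B rewrite splitAt-↑ʳ (n + k) 2 (suc zero) = refl

  network-var-B : ∀ v → x B ≡ true → network φ x (varIdx n k v) ≡ true
  network-var-B v xB rewrite network-var v | xB = ∨-zeroʳ _

  network-cls-B : ∀ j → x B ≡ true → network φ x (clauseIdx n k j) ≡ true
  network-cls-B j xB rewrite network-cls j | xB = ∨-zeroʳ _

  network-A-B : x B ≡ true → network φ x A ≡ false
  network-A-B xB rewrite network-A | xB = ∧-zeroʳ _

  network-B-B : x B ≡ true → network φ x B ≡ false
  network-B-B xB rewrite network-B | xB = ∧-zeroʳ _

  network-var-A¬B : ∀ v → x A ≡ true → x B ≡ false → network φ x (varIdx n k v) ≡ false
  network-var-A¬B v xA xB rewrite network-var v | xA | xB = trans (∨-identityʳ _) (∧-zeroʳ _)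

  network-cls-A¬B : ∀ j → x A ≡ true → x B ≡ false → network φ x (clauseIdx n k j) ≡ false
  network-cls-A¬B j xA xB rewrite network-cls j | xA | xB = trans (∨-identityʳ _) (∧-zeroʳ _)

  network-B-A¬B : x A ≡ true → x B ≡ false → network φ x B ≡ true
  network-B-A¬B xA xB rewrite network-B | xA | xB = refl

  network-var-¬A¬B : ∀ v → x A ≡ false → x B ≡ false →
                     network φ x (varIdx n k v) ≡ x (varIdx n k v)
  network-var-¬A¬B v xA xB rewrite network-var v | xA | xB = trans (∨-identityʳ _) (∧-identityʳ _)

  network-cls-¬A¬B : ∀ j → x A ≡ false → x B ≡ false →
                     network φ x (clauseIdx n k j) ≡ evalClause (clause φ j) (x ∘ varIdx n k)
  network-cls-¬A¬B j xA xB rewrite network-cls j | xA | xB = trans (∨-identityʳ _) (∧-identityʳ _)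

  network-A-¬B : x B ≡ false → network φ x A ≡ anyFin (x ∘ clauseIdx n k)
  network-A-¬B xB rewrite network-A | xB = ∧-identityʳ _

  network-B-¬A : x A ≡ false → network φ x B ≡ false
  network-B-¬A xA rewrite network-B | xA = refl

module _ {n : ℕ} (φ : DNF n) (valid : ∀ y → evalDNF φ y ≡ true)
         {h : SubHypercube (n + length φ + 2)} (trap : IsTrapSpace (network φ) h) where
  private
    k : ℕ
    k = length φ
    A B : Fin (n + k + 2)
    A = idxA n k
    B = idxB n k

    corner : Bool → Bool → State (n + k + 2)
    corner = assemble n k (const true) (const true)

    probe : Bool → Bool → State (n + k + 2)
    probe a b = vertex h (corner a b)

    probe-∈v : ∀ {a b} → probe a b ∈v h
    probe-∈v = vertex-∈v h _

    B-not-true : ¬ (h B ≡ just true)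
    B-not-true hB = trap-clash trap probe-∈v hB (network-B-B φ (probe-∈v {true} {true} B true hB))

    A-not-true : ¬ (h A ≡ just true)
    A-not-true hA = caseB (probe true true B) refl
      where
      caseB : ∀ b → probe true true B ≡ b → ⊥
      caseB true  xB = trap-clash trap probe-∈v hA (network-A-B φ xB)
      caseB false xB = trap-clash trap probe-∈v (vertex-moved xB assemble-B)
                         (network-B-A¬B φ (probe-∈v A true hA) xB)

    A-not-false : ¬ (h A ≡ just false)
    A-not-false hA = caseB (x B) refl
      where
      x : State (n + k + 2)
      x = probe true false
      xA : x A ≡ false
      xA = probe-∈v A false hA
      cls-fixed : x B ≡ false → ∀ j → h (clauseIdx n k j) ≡ just false
      cls-fixed xB j = vertex-moved
        (anyFin-false⁻ _ (trans (sym (network-A-¬B φ xB)) (trap x probe-∈v A false hA)) j)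
        (assemble-cls j)
      caseB : ∀ b → x B ≡ b → ⊥
      caseB true  xB = B-not-true (vertex-moved xB assemble-B)
      caseB false xB with j , cj ← evalDNF-true⁻ φ (x ∘ varIdx n k) (valid _) =
        trap-clash trap probe-∈v (cls-fixed xB j) (trans (network-cls-¬A¬B φ j xA xB) cj)

    A-free : h A ≡ nothing
    A-free = free-if-unfixed A-not-true A-not-false

    B-not-false : ¬ (h B ≡ just false)
    B-not-false hB = trap-clash trap (probe-∈v {true} {false}) hB
      (network-B-A¬B φ (trans (vertex-free A-free) assemble-A) (probe-∈v B false hB))

    B-free : h B ≡ nothing
    B-free = free-if-unfixed B-not-true B-not-false

    probe-A : ∀ {a b} → probe a b A ≡ a
    probe-A = trans (vertex-free A-free) assemble-A

    probe-B : ∀ {a b} → probe a b B ≡ b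
    probe-B = trans (vertex-free B-free) assemble-B

    inner-free : ∀ {i} → network φ (probe true true) i ≡ true →
                 network φ (probe true false) i ≡ false → h i ≡ nothing
    inner-free set cleared = free-if-unfixed (λ hi → trap-clash trap probe-∈v hi cleared)
                                             (λ hi → trap-clash trap probe-∈v hi set)

  valid⇒trapSpace-free : ∀ i → h i ≡ nothing
  valid⇒trapSpace-free i with coordinate n k i
  ... | var v = inner-free (network-var-B φ v probe-B) (network-var-A¬B φ v probe-A probe-B)
  ... | cls j = inner-free (network-cls-B φ j probe-B) (network-cls-A¬B φ j probe-A probe-B)
  ... | ctlA  = A-free
  ... | ctlB  = B-free

module _ {n : ℕ} (φ : DNF n) {y : State n} (φy≡false : evalDNF φ y ≡ false) where
  private
    k : ℕ
    k = length φ
    A B : Fin (n + k + 2)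
    A = idxA n k
    B = idxB n k

    x* : State (n + k + 2)
    x* = assemble n k y (const false) false false

    network-fixes-x* : ∀ {x} → x ≗ x* → ∀ {i} → Coordinate n k i → network φ x i ≡ x* i
    network-fixes-x* {x} x≗x* = λ where
        (var v) → trans (network-var-¬A¬B φ v xA xB) (x≗x* _)
        (cls j) → begin
          network φ x (clauseIdx n k j)                     ≡⟨ network-cls-¬A¬B φ j xA xB ⟩
          evalClause (clause φ j) (x ∘ varIdx n k)          ≡⟨ evalClause-cong (clause φ j) x≗y ⟩
          evalClause (clause φ j) y                         ≡⟨ evalDNF-false⁻ φ y φy≡false j ⟩
          false                                             ≡⟨ assemble-cls j ⟨
          x* (clauseIdx n k j)                              ∎
        ctlA → trans (network-A-¬B φ xB)
                     (trans (anyFin-false _ λ j → trans (x≗x* _) (assemble-cls j))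
                            (sym assemble-A))
        ctlB → trans (network-B-¬A φ xA) (sym assemble-B)
      where
      open ≡-Reasoning
      xA : x A ≡ false
      xA = trans (x≗x* A) assemble-A
      xB : x B ≡ false
      xB = trans (x≗x* B) assemble-B
      x≗y : x ∘ varIdx n k ≗ y
      x≗y v = trans (x≗x* _) (assemble-var v)

    x*-trap : IsTrapSpace (network φ) (just ∘ x*)
    x*-trap x x∈x* i _ refl = network-fixes-x* (λ j → x∈x* j _ refl) (coordinate n k i)

  falsifiable⇒¬uniqueMinimalAllStar : ¬ UniqueMinimalAllStar (network φ)
  falsifiable⇒¬uniqueMinimalAllStar unique =
    allStar-minimal⇒unfixed {i = A} (proj₁ unique) x*-trap refl

lemma2 : (n : ℕ) → .{{_ : NonZero n}} → (φ : DNF n) →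
    ((∀ (y : State n) → evalDNF φ y ≡ true) ⇔ UniqueMinimalAllStar (network φ))
lemma2 n φ = mk⇔
  (λ valid → uniqueMinimalAllStar-intro λ _ trap → valid⇒trapSpace-free φ valid trap)
  (λ unique y → ¬-not λ φy≡false → falsifiable⇒¬uniqueMinimalAllStar φ φy≡false unique)
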